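{- Let $G=(V,E)$ and $G'=(V',E')$ be graphs, let $\mathcal{S}$ be a set of distributions on $G$, and let $D$ be an $\mathcal{S}$-solvable distribution on $G$. Let $\{D'_r\}_{r\ge 0}$ be a family of distributions on $G'$ such that $D'_r$ is $r$-solvable for each $r\ge1$ ($D'_0$ arbitrary). Define the distribution $\Delta$ on $G\Box G'$ by $\Delta((v,w))=D'_{D(v)}(w)$. Then $\Delta$ is $(\mathcal{S}\cdot\mathcal{S}_1(G'))$-solvable in $G\Box G'$; that is, for every $\overline{D}\in\mathcal{S}$ and every $w\in V'$, the distribution on $G\Box G'$ placing $\overline{D}(v)$ pebbles on $(v,w)$ for each $v\in V$ (and none elsewhere) is reachable from $\Delta$.
   Context: Graphs are finite simple graphs. A distribution on a graph $G=(V,E)$ is a function $D:V\to\mathbb{N}$. $D$ contains $D'$ if $D'(v)\le D(v)$ for all $v$. A pebbling move removes two pebbles from a vertex having at least two pebbles and places one pebble on a neighbor. $D_2$ is reachable from $D_1$ if some sequence of pebbling moves starting from $D_1$ results in a distribution containing $D_2$. For a set $\mathcal{S}$ of distributions, $D$ is $\mathcal{S}$-solvable if every distribution in $\mathcal{S}$ is reachable from $D$. $D$ is $r$-solvable if, for every vertex $v$, the distribution with $r$ pebbles on $v$ and none elsewhere is reachable from $D$. $\mathcal{S}_1(G')$ is the set of distributions on $G'$ with one pebble on a single vertex and none elsewhere. $G\Box G'$ is the Cartesian product; for distributions $D$ on $G$, $D'$ on $G'$, $(D\cdot D')((x,x'))=D(x)D'(x')$, and $\mathcal{S}\cdot\mathcal{S}'=\{D\cdot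 D': D\in\mathcal{S},D'\in\mathcal{S}'\}$. -}

module Defs where

open import Level using (0ℓ)
open import Data.Nat using (ℕ; zero; suc; _+_; _*_; _≤_)
open import Data.Fin using (Fin)
open import Data.Product using (_×_; _,_; proj₁; proj₂; Σ; ∃)
open import Data.Sum using (_⊎_)
open import Relation.Nullary using (¬_; Dec; yes; no)
open import Relation.Binary.PropositionalEquality using (_≡_; _≢_)
open import Relation.Binary.Definitions using (DecidableEquality)
open import Relation.Binary.Construct.Closure.ReflexiveTransitive using (Star)
open import Function.Bundles using (_↔_)

record Graph : Set₁ where
  field
    V       : Set
    size    : ℕ
    finite  : V ↔ Fin size
    _≟_     : DecidableEquality V
    Adj     : V → V → Set
    irrefl  : ∀ {x} → ¬ Adj x x
    sym     : ∀ {x y} → Adj x y → Adj y x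

open Graph public

Distribution : Graph → Set
Distribution G = V G → ℕ

_⊒_ : {G : Graph} → Distribution G → Distribution G → Set
_⊒_ {G} D D' = ∀ (v : V G) → D' v ≤ D v

record PebblingMove (G : Graph) (D₁ D₂ : Distribution G) : Set where
  field
    from     : V G
    to       : V G
    adj      : Adj G from to
    enough   : 2 ≤ D₁ from
    atFrom   : D₂ from + 2 ≡ D₁ from
    atTo     : D₂ to ≡ D₁ to + 1
    elsewhere : ∀ v → v ≢ from → v ≢ to → D₂ v ≡ D₁ v

_⟶*_ : {G : Graph} → Distribution G → Distribution G → Set
_⟶*_ {G} = Star (PebblingMove G)

Reachable : (G : Graph) → Distribution G → Distribution G → Set
Reachable G D₁ D₂ = ∃ λ (D : Distribution G) → (_⟶*_ {G} D₁ D) × (_⊒_ {G} D D₂)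

DistSet : Graph → Set₁
DistSet G = Distribution G → Set

Solvable : (G : Graph) → DistSet G → Distribution G → Set
Solvable G S D = ∀ D̄ → S D̄ → Reachable G D D̄

single : (G : Graph) → V G → ℕ → Distribution G
single G v r x with _≟_ G x v
... | yes _ = r
... | no  _ = 0

RSolvable : (G : Graph) → ℕ → Distribution G → Set
RSolvable G r D = ∀ (v : V G) → Reachable G D (single G v r)

S₁ : (G : Graph) → DistSet G
S₁ G D = ∃ λ (v : V G) → D ≡ single G v 1

open import Function.Properties.Inverse using (↔-sym; ↔-trans)
open import Data.Product.Function.NonDependent.Propositional using (_×-cong_)
open import Data.Fin.Properties using (*↔×)
open import Data.Product.Properties using (≡-dec)
open import Relation.Binary.PropositionalEquality using (refl; subst)

prodAdj : (G G' : Graph) → V G × V G' → V G × V G' → Set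
prodAdj G G' (x , x') (y , y') =
  (Adj G x y × x' ≡ y') ⊎ (x ≡ y × Adj G' x' y')

prodIrrefl : (G G' : Graph) → ∀ {p} → ¬ prodAdj G G' p p
prodIrrefl G G' (Data.Sum.inj₁ (a , _)) = irrefl G a
prodIrrefl G G' (Data.Sum.inj₂ (_ , a)) = irrefl G' a

prodSym : (G G' : Graph) → ∀ {p q} → prodAdj G G' p q → prodAdj G G' q p
prodSym G G' (Data.Sum.inj₁ (a , refl)) = Data.Sum.inj₁ (sym G a , refl)
prodSym G G' (Data.Sum.inj₂ (refl , a)) = Data.Sum.inj₂ (refl , sym G' a)

_□_ : Graph → Graph → Graph
G □ G' = record
  { V      = V G × V G'
  ; size   = size G * size G'
  ; finite = ↔-trans (finite G ×-cong finite G') (↔-sym *↔×)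
  ; _≟_    = ≡-dec (_≟_ G) (_≟_ G')
  ; Adj    = prodAdj G G'
  ; irrefl = prodIrrefl G G'
  ; sym    = prodSym G G'
  }

_·_ : {G G' : Graph} → Distribution G → Distribution G' → Distribution (G □ G')
(D · D') (x , x') = D x * D' x'

_·ˢ_ : {G G' : Graph} → DistSet G → DistSet G' → DistSet (G □ G')
_·ˢ_ {G} {G'} S S' E =
  ∃ λ (D : Distribution G) → ∃ λ (D' : Distribution G') → S D × S' D' × E ≡ (_·_ {G} {G'} D D')

Δ : (G G' : Graph) → Distribution G → (ℕ → Distribution G') → Distribution (G □ G')
Δ G G' D D'fam (v , w) = D'fam (D v) w

-- Solve the product in two phases.  First, fibre by fibre: on {v} × G' the
-- distribution Δ restricts to D'_{D v}, which is (D v)-solvable, so D v pebbles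
-- can be gathered on (v , w); afterwards the row G × {w} holds (a superset of)
-- a copy of D.  Second, the pebbling moves taking D to a superset of D̄ in G are
-- replayed inside that row.  Both phases are instances of one fact: moves of a
-- graph embedded in G □ G' lift to moves of G □ G' leaving everything outside
-- the image untouched.  Containment is preserved by pebbling, which makes
-- reachability transitive, so the phases compose.
module Submission where

open import Defs
open import Data.Nat using (ℕ; zero; suc; _+_; _*_; _∸_; _≤_; z≤n)
open import Data.Nat.Properties
  using (≤-refl; ≤-reflexive; ≤-trans; +-assoc; m≤n+m; m∸n+n≡m; *-identityʳ; *-zeroʳ)
open import Data.List using (List; []; _∷_; map; allFin)
open import Data.List.Membership.Propositional using (_∈_)
open import Data.List.Membership.Propositional.Properties using (∈-map⁺; ∈-allFin)
open import Data.List.Relation.Unary.Any using (here; there)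
open import Data.Product using (∃; _×_; _,_; proj₁; proj₂)
open import Data.Sum using (_⊎_; inj₁; inj₂; [_,_]′)
open import Data.Empty using (⊥-elim)
open import Relation.Nullary using (Dec; yes; no)
open import Relation.Binary.PropositionalEquality
  using (_≡_; _≢_; refl; cong; trans; subst; module ≡-Reasoning)
  renaming (sym to ≡-sym)
open import Relation.Binary.Construct.Closure.ReflexiveTransitive using (ε; _◅_; _◅◅_)
open import Function.Bundles using (Inverse)

⊒-trans : {G : Graph} {A B C : Distribution G} →
  _⊒_ {G} A B → _⊒_ {G} B C → _⊒_ {G} A C
⊒-trans A⊒B B⊒C v = ≤-trans (B⊒C v) (A⊒B v)

-- The surplus A ∸ A' is simply carried along.
move-from-⊒ : {G : Graph} {A A' B' : Distribution G} → _⊒_ {G} A A' →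
  PebblingMove G A' B' → ∃ λ B → PebblingMove G A B × _⊒_ {G} B B'
move-from-⊒ {G} {A} {A'} {B'} A⊒A' m =
  B , record
    { from = from ; to = to ; adj = adj
    ; enough = ≤-trans enough (A⊒A' from)
    ; atFrom = begin
        surplus from + B' from + 2   ≡⟨ +-assoc (surplus from) (B' from) 2 ⟩
        surplus from + (B' from + 2) ≡⟨ cong (surplus from +_) atFrom ⟩
        surplus from + A' from       ≡⟨ m∸n+n≡m (A⊒A' from) ⟩
        A from                       ∎
    ; atTo = begin
        surplus to + B' to           ≡⟨ cong (surplus to +_) atTo ⟩
        surplus to + (A' to + 1)     ≡⟨ ≡-sym (+-assoc (surplus to) (A' to) 1) ⟩
        surplus to + A' to + 1       ≡⟨ cong (_+ 1) (m∸n+n≡m (A⊒A' to)) ⟩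
        A to + 1                     ∎
    ; elsewhere = λ v v≢from v≢to →
        trans (cong (surplus v +_) (elsewhere v v≢from v≢to)) (m∸n+n≡m (A⊒A' v))
    } , λ v → m≤n+m (B' v) (surplus v)
  where
  open PebblingMove m
  open ≡-Reasoning
  surplus : V G → ℕ
  surplus v = A v ∸ A' v
  B : Distribution G
  B v = surplus v + B' v

⟶*-from-⊒ : {G : Graph} {A A' C' : Distribution G} → _⊒_ {G} A A' →
  _⟶*_ {G} A' C' → ∃ λ C → _⟶*_ {G} A C × _⊒_ {G} C C'
⟶*-from-⊒ A⊒A' ε = _ , ε , A⊒A'
⟶*-from-⊒ A⊒A' (m ◅ ms) with move-from-⊒ A⊒A' m
... | B , m' , B⊒B' with ⟶*-from-⊒ B⊒B' ms
... | C , ms' , C⊒C' = C , m' ◅ ms' , C⊒C'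

⊒⇒Reachable : {G : Graph} {A B : Distribution G} → _⊒_ {G} A B → Reachable G A B
⊒⇒Reachable A⊒B = _ , ε , A⊒B

Reachable-trans : {G : Graph} {A B C : Distribution G} →
  Reachable G A B → Reachable G B C → Reachable G A C
Reachable-trans {G} (X , A⟶X , X⊒B) (Y , B⟶Y , Y⊒C) with ⟶*-from-⊒ X⊒B B⟶Y
... | Z , X⟶Z , Z⊒Y = Z , A⟶X ◅◅ X⟶Z , ⊒-trans {G} Z⊒Y Y⊒C

-- An adjacency-preserving map with a left inverse; the left inverse makes
-- membership in the image decidable (y is in it iff y ≡ embed (retract y)).
record Embedding (G H : Graph) : Set where
  field
    embed          : V G → V H
    retract        : V H → V G
    retract∘embed  : ∀ x → retract (embed x) ≡ x
    embed-adj      : ∀ {x y} → Adj G x y → Adj H (embed x) (embed y)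

module _ {G H : Graph} (e : Embedding G H) where
  open Embedding e

  overlay : Distribution H → Distribution G → Distribution H
  overlay P A y with _≟_ H y (embed (retract y))
  ... | yes _ = A (retract y)
  ... | no  _ = P y

  overlay-embed : ∀ P A x → overlay P A (embed x) ≡ A x
  overlay-embed P A x with _≟_ H (embed x) (embed (retract (embed x)))
  ... | yes _ = cong A (retract∘embed x)
  ... | no ¬e = ⊥-elim (¬e (cong embed (≡-sym (retract∘embed x))))

  overlay-mono : ∀ P {A B} → _⊒_ {G} A B → _⊒_ {H} (overlay P A) (overlay P B)
  overlay-mono P A⊒B y with _≟_ H y (embed (retract y))
  ... | yes _ = A⊒B (retract y)
  ... | no  _ = ≤-refl

  overlay-move : ∀ P {A B} → PebblingMove G A B →
    PebblingMove H (overlay P A) (overlay P B)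
  overlay-move P {A} {B} m = record
    { from = embed from ; to = embed to ; adj = embed-adj adj
    ; enough = subst (2 ≤_) (≡-sym (overlay-embed P A from)) enough
    ; atFrom = trans (cong (_+ 2) (overlay-embed P B from))
                     (trans atFrom (≡-sym (overlay-embed P A from)))
    ; atTo = trans (overlay-embed P B to)
                   (trans atTo (cong (_+ 1) (≡-sym (overlay-embed P A to))))
    ; elsewhere = unchanged
    }
    where
    open PebblingMove m
    unchanged : ∀ y → y ≢ embed from → y ≢ embed to → overlay P B y ≡ overlay P A y
    unchanged y y≢from y≢to with _≟_ H y (embed (retract y))
    ... | yes y≡ = elsewhere (retract y) (λ r≡ → y≢from (trans y≡ (cong embed r≡)))
                                         (λ r≡ → y≢to (trans y≡ (cong embed r≡)))
    ... | no  _ = refl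

  overlay-⟶* : ∀ P {A B} → _⟶*_ {G} A B → _⟶*_ {H} (overlay P A) (overlay P B)
  overlay-⟶* P ε = ε
  overlay-⟶* P (m ◅ ms) = overlay-move P m ◅ overlay-⟶* P ms

  overlay-Reachable : ∀ P {A B} → Reachable G A B →
    Reachable H (overlay P A) (overlay P B)
  overlay-Reachable P (C , A⟶C , C⊒B) = overlay P C , overlay-⟶* P A⟶C , overlay-mono P C⊒B

fibre-embedding : (G G' : Graph) → V G → Embedding G' (G □ G')
fibre-embedding G G' v = record
  { embed = v ,_ ; retract = proj₂ ; retract∘embed = λ _ → refl
  ; embed-adj = λ a → inj₂ (refl , a) }

row-embedding : (G G' : Graph) → V G' → Embedding G (G □ G')
row-embedding G G' w = record
  { embed = _, w ; retract = proj₁ ; retract∘embed = λ _ → refl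
  ; embed-adj = λ a → inj₁ (a , refl) }

vertices : (G : Graph) → List (V G)
vertices G = map (Inverse.from (finite G)) (allFin (size G))

∈-vertices : (G : Graph) (v : V G) → v ∈ vertices G
∈-vertices G v = subst (_∈ vertices G) (Inverse.strictlyInverseʳ (finite G) v)
  (∈-map⁺ (Inverse.from (finite G)) (∈-allFin (Inverse.to (finite G) v)))

module _ (G G' : Graph) where

  fibre : Distribution (G □ G') → V G → Distribution G'
  fibre P v x = P (v , x)

  overlay-fibre : V G → Distribution (G □ G') → Distribution G' → Distribution (G □ G')
  overlay-fibre v = overlay (fibre-embedding G G' v)

  overlay-fibre-self : ∀ v P → _⊒_ {G □ G'} P (overlay-fibre v P (fibre P v))
  overlay-fibre-self v P (u , x) with _≟_ (G □ G') (u , x) (v , x)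
  ... | yes refl = ≤-refl
  ... | no  _    = ≤-refl

  overlay-fibre-same : ∀ v P A → _⊒_ {G'} (fibre (overlay-fibre v P A) v) A
  overlay-fibre-same v P A x = ≤-reflexive (≡-sym (overlay-embed (fibre-embedding G G' v) P A x))

  overlay-fibre-other : ∀ {u v} P A → u ≢ v → _⊒_ {G'} (fibre (overlay-fibre v P A) u) (fibre P u)
  overlay-fibre-other {u} {v} P A u≢v x with _≟_ (G □ G') (u , x) (v , x)
  ... | yes u,x≡v,x = ⊥-elim (u≢v (cong proj₁ u,x≡v,x))
  ... | no  _       = ≤-refl

  -- Invariant: every fibre not yet contained in its target is listed in vs.
  fibrewise-Reachable′ : (vs : List (V G)) (P Q : Distribution (G □ G')) →
    (∀ v → Reachable G' (fibre P v) (fibre Q v)) →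
    (∀ v → v ∈ vs ⊎ _⊒_ {G'} (fibre P v) (fibre Q v)) →
    Reachable (G □ G') P Q
  fibrewise-Reachable′ [] P Q _ settled =
    ⊒⇒Reachable λ { (v , x) → [ (λ ()) , (λ P⊒Q → P⊒Q x) ]′ (settled v) }
  fibrewise-Reachable′ (u ∷ us) P Q reach settled =
    Reachable-trans
      (Reachable-trans (⊒⇒Reachable (overlay-fibre-self u P))
                       (overlay-Reachable (fibre-embedding G G' u) P (reach u)))
      (fibrewise-Reachable′ us P' Q reach' settled')
    where
    P' : Distribution (G □ G')
    P' = overlay-fibre u P (fibre Q u)

    fibre-P' : ∀ v → _⊒_ {G'} (fibre P' v) (fibre Q v)
                   ⊎ (v ≢ u × _⊒_ {G'} (fibre P' v) (fibre P v))
    fibre-P' v = by-cases (_≟_ G v u)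
      where
      by-cases : Dec (v ≡ u) → _⊒_ {G'} (fibre P' v) (fibre Q v)
                             ⊎ (v ≢ u × _⊒_ {G'} (fibre P' v) (fibre P v))
      by-cases (yes refl) = inj₁ (overlay-fibre-same u P (fibre Q u))
      by-cases (no v≢u)   = inj₂ (v≢u , overlay-fibre-other P (fibre Q u) v≢u)

    reach' : ∀ v → Reachable G' (fibre P' v) (fibre Q v)
    reach' v = [ ⊒⇒Reachable , (λ (_ , P'⊒P) → Reachable-trans (⊒⇒Reachable P'⊒P) (reach v)) ]′
                 (fibre-P' v)

    settled' : ∀ v → v ∈ us ⊎ _⊒_ {G'} (fibre P' v) (fibre Q v)
    settled' v with fibre-P' v | settled v
    ... | inj₁ P'⊒Q         | _                 = inj₂ P'⊒Q
    ... | inj₂ (v≢u , _)    | inj₁ (here v≡u)   = ⊥-elim (v≢u v≡u)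
    ... | inj₂ _            | inj₁ (there v∈us) = inj₁ v∈us
    ... | inj₂ (_ , P'⊒P)   | inj₂ P⊒Q          = inj₂ (⊒-trans {G'} P'⊒P P⊒Q)

  fibrewise-Reachable : (P Q : Distribution (G □ G')) →
    (∀ v → Reachable G' (fibre P v) (fibre Q v)) → Reachable (G □ G') P Q
  fibrewise-Reachable P Q reach =
    fibrewise-Reachable′ (vertices G) P Q reach (λ v → inj₁ (∈-vertices G v))

single-⊒-scaled : (G : Graph) (w : V G) (r : ℕ) →
  _⊒_ {G} (single G w r) (λ x → r * single G w 1 x)
single-⊒-scaled G w r x with _≟_ G x w
... | yes _ = ≤-reflexive (*-identityʳ r)
... | no  _ = ≤-reflexive (*-zeroʳ r)

Reachable-scaled-single : (G : Graph) (D' : ℕ → Distribution G) →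
  (∀ r → RSolvable G (suc r) (D' (suc r))) →
  ∀ w n → Reachable G (D' n) (λ x → n * single G w 1 x)
Reachable-scaled-single G D' solvable w zero    = ⊒⇒Reachable {G} λ _ → z≤n
Reachable-scaled-single G D' solvable w (suc r) =
  Reachable-trans {G} (solvable r w) (⊒⇒Reachable {G} (single-⊒-scaled G w (suc r)))

module _ (G G' : Graph) (w : V G') where

  overlay-row-zero : ∀ A p →
    overlay (row-embedding G G' w) (λ _ → 0) A p ≡ (_·_ {G} {G'} A (single G' w 1)) p
  overlay-row-zero A (v , x) with _≟_ (G □ G') (v , x) (v , w) | _≟_ G' x w
  ... | yes refl | yes _   = ≡-sym (*-identityʳ (A v))
  ... | yes refl | no x≢w  = ⊥-elim (x≢w refl)
  ... | no ne    | yes refl = ⊥-elim (ne refl)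
  ... | no _     | no _    = ≡-sym (*-zeroʳ (A v))

  row-Reachable : {A B : Distribution G} → Reachable G A B →
    Reachable (G □ G') (_·_ {G} {G'} A (single G' w 1)) (_·_ {G} {G'} B (single G' w 1))
  row-Reachable {A} {B} A⟶B =
    Reachable-trans {G □ G'} (⊒⇒Reachable {G □ G'} λ p → ≤-reflexive (overlay-row-zero A p))
      (Reachable-trans {G □ G'} (overlay-Reachable (row-embedding G G' w) (λ _ → 0) A⟶B)
        (⊒⇒Reachable {G □ G'} λ p → ≤-reflexive (≡-sym (overlay-row-zero B p))))

theorem5p6 : (G G' : Graph) (S : DistSet G) (D : Distribution G) →
    Solvable G S D →
    (D'fam : ℕ → Distribution G') →
    (∀ r → RSolvable G' (suc r) (D'fam (suc r))) →
    Solvable (G □ G') (_·ˢ_ {G} {G'} S (S₁ G')) (Δ G G' D D'fam)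
theorem5p6 G G' S D D-solvable D'fam D'-solvable _ (D̄ , _ , D̄∈S , (w , refl) , refl) =
  Reachable-trans {G □ G'}
    (fibrewise-Reachable G G' (Δ G G' D D'fam) (_·_ {G} {G'} D (single G' w 1))
      (λ v → Reachable-scaled-single G' D'fam D'-solvable w (D v)))
    (row-Reachable G G' w (D-solvable D̄ D̄∈S))
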